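{- Let $k\geq 2$ be an integer and, for $n\geq 0$, let $a_{k,n}$ denote the number of even-up words over $k$ of length $n$. Let $A_k(x)=\sum_{n\geq 0}a_{k,n}x^n$. Then \[A_k(x)=\frac{(x+1)^{\lfloor k/2\rfloor}}{2-(x+1)^{\lfloor (k+1)/2\rfloor}}.\]
   Context: For an integer $k\geq 2$, let $[k]=\{1,\ldots,k\}$. A word over $k$ of length $n$ is an element $w_1\cdots w_n\in[k]^n$ (for $n=0$ there is exactly one word, the empty word). A word $w_1\cdots w_n\in[k]^n$ is even-up if for every $i\in[n-1]$, whenever $w_i$ is even, $w_{i+1}>w_i$. -}

module Defs where

open import Data.Nat using (ℕ; zero; suc; _<_; _<?_; _∸_; _≟_)
open import Data.Nat.Divisibility using (_∣_; _∣?_)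
open import Data.Nat.Combinatorics using (_C_)
open import Data.Fin using (Fin; toℕ)
open import Data.Fin.Properties using (all?)
open import Data.Vec using (Vec; []; _∷_; lookup)
open import Data.List using (List; []; _∷_; map; concatMap; filter; length; foldr; upTo; allFin)
open import Data.Integer using (ℤ; +_; _-_) renaming (_*_ to _*ℤ_; _+_ to _+ℤ_)
open import Relation.Nullary using (Dec; yes; no)
open import Relation.Nullary.Decidable using (_→-dec_)
open import Relation.Binary.PropositionalEquality using (_≡_)

-- A letter x : Fin k represents the integer val x ∈ [k] = {1,…,k}.
val : {k : ℕ} → Fin k → ℕ
val x = suc (toℕ x)

Even : ℕ → Set
Even m = 2 ∣ m

EvenUp : {k n : ℕ} → Vec (Fin k) n → Set
EvenUp {k} {n} w = (i j : Fin n) → toℕ j ≡ suc (toℕ i) →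
  Even (val (lookup w i)) → val (lookup w i) < val (lookup w j)

evenUp? : {k n : ℕ} (w : Vec (Fin k) n) → Dec (EvenUp w)
evenUp? w = all? λ i → all? λ j →
  (toℕ j ≟ suc (toℕ i)) →-dec ((2 ∣? val (lookup w i)) →-dec (val (lookup w i) <? val (lookup w j)))

words : (k n : ℕ) → List (Vec (Fin k) n)
words k zero = [] ∷ []
words k (suc n) = concatMap (λ x → map (x ∷_) (words k n)) (allFin k)

a : (k n : ℕ) → ℕ
a k n = length (filter evenUp? (words k n))

-- Formal power series over ℤ as coefficient sequences, with Cauchy product.
Series : Set
Series = ℕ → ℤ

_⊛_ : Series → Series → Series
(f ⊛ g) n = foldr _+ℤ_ (+ 0) (map (λ j → f j *ℤ g (n ∸ j)) (upTo (suc n)))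

A : ℕ → Series
A k n = + a k n

onePlusXPow : ℕ → Series
onePlusXPow m n = + (m C n)

two : Series
two zero = + 2
two (suc _) = + 0

denom : ℕ → Series
denom m n = two n - onePlusXPow m n

{-# OPTIONS --safe #-}

-- Let A_v be the generating function of the even-up words (the empty word included) whose
-- first letter exceeds v, so that A_0 = A_k. After a letter y an even-up word continues
-- as an even-up word whose first letter exceeds threshold y, which is y for even y and 0
-- for odd y. Splitting off the words that start with v + 1 gives
--   A_v = A_{v+1} + x A_{threshold (v+1)}  for v < k,   and   A_k = 1,
-- so two steps from an even v give A_v = (1 + x) A_{v+2} + x A. By induction on the
-- number r = k - v of letters above an even v,
--   A_v + A = (1 + x)^⌊r/2⌋ + A (1 + x)^⌈r/2⌉,
-- and v = 0 gives A (2 - (1 + x)^⌈k/2⌉) = (1 + x)^⌊k/2⌋.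
module Submission where

open import Defs
open import Data.Nat using (ℕ; zero; suc; _+_; _*_; _∸_; _/_; _≤_; _<_; _<?_; z≤n; s≤s; s≤s⁻¹; pred)
open import Data.Nat.Properties
  using (<-irrefl; <-≤-trans; ≤-trans; ≤-reflexive; <⇒≱; m≤m+n; +-suc; +-identityʳ; +-comm; *-comm; *-suc; even≢odd)
open import Data.Nat.DivMod using (m/n≡1+[m∸n]/n)
open import Data.Nat.Divisibility using (_∣?_; divides; m∣m*n)
open import Data.Nat.Combinatorics using (_C_; nCk+nC[k+1]≡[n+1]C[k+1])
open import Data.Nat.ListAction using (sum)
import Data.Nat.Tactic.RingSolver as ℕ-Solver
open import Data.Integer using (ℤ; +_; _-_) renaming (_+_ to _+ℤ_; _*_ to _*ℤ_)
import Data.Integer.Properties as ℤ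
open import Data.Integer.Tactic.RingSolver using (solve-∀)
open import Data.Fin using (Fin; toℕ; zero; suc)
open import Data.Fin.Properties using (toℕ<n)
open import Data.Vec using (Vec; []; _∷_)
open import Data.List using (List; []; _∷_; _++_; map; concatMap; filter; length; foldr; applyUpTo; allFin; tabulate)
open import Data.List.Properties
  using (length-map; length-++; filter-≐; filter-none; filter-accept; filter-++; map-cong; map-tabulate; map-applyUpTo; map-upTo)
open import Data.List.Relation.Unary.All using (universal)
open import Data.Product using (_×_; _,_; proj₁; proj₂)
open import Data.Unit using (⊤; tt)
open import Data.Bool using (if_then_else_)
open import Function using (_∘_; id; _⇔_; mk⇔; Equivalence)
open import Level using (0ℓ)
open import Relation.Nullary using (Dec; yes; no; ¬_; does; contradiction)
open import Relation.Nullary.Decidable using (_×-dec_; dec-true; dec-false)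
open import Relation.Unary using (Pred; Decidable)
open import Relation.Binary.PropositionalEquality using (_≡_; refl; sym; trans; cong; cong₂; _≗_; module ≡-Reasoning)
open ≡-Reasoning

⊛-zero : ∀ (f g : Series) → (f ⊛ g) 0 ≡ f 0 *ℤ g 0
⊛-zero f g = ℤ.+-identityʳ (f 0 *ℤ g 0)

⊛-suc : ∀ (f g : Series) n → (f ⊛ g) (suc n) ≡ f 0 *ℤ g (suc n) +ℤ ((f ∘ suc) ⊛ g) n
⊛-suc f g n = cong (λ xs → f 0 *ℤ g (suc n) +ℤ foldr _+ℤ_ (+ 0) xs)
  (trans (map-applyUpTo suc (λ j → f j *ℤ g (suc n ∸ j)) (suc n))
         (sym (map-upTo (λ j → f (suc j) *ℤ g (n ∸ j)) (suc n))))

⊛-impulse : ∀ (f g : Series) → (∀ i → g (suc i) ≡ + 0) → ∀ n → (f ⊛ g) n ≡ f n *ℤ g 0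
⊛-impulse f g g≡0 zero    = ⊛-zero f g
⊛-impulse f g g≡0 (suc n) = begin
  (f ⊛ g) (suc n)                         ≡⟨ ⊛-suc f g n ⟩
  f 0 *ℤ g (suc n) +ℤ ((f ∘ suc) ⊛ g) n   ≡⟨ cong₂ (λ x y → f 0 *ℤ x +ℤ y) (g≡0 n) (⊛-impulse (f ∘ suc) g g≡0 n) ⟩
  f 0 *ℤ + 0 +ℤ f (suc n) *ℤ g 0          ≡⟨ cong (_+ℤ f (suc n) *ℤ g 0) (ℤ.*-zeroʳ (f 0)) ⟩
  + 0 +ℤ f (suc n) *ℤ g 0                 ≡⟨ ℤ.+-identityˡ (f (suc n) *ℤ g 0) ⟩
  f (suc n) *ℤ g 0                        ∎

⊛-distribˡ-minus : ∀ (f g h : Series) n → (f ⊛ (λ i → g i - h i)) n ≡ (f ⊛ g) n - (f ⊛ h) n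
⊛-distribˡ-minus f g h zero = ring (f 0) (g 0) (h 0)
  where
  ring : ∀ a b c → a *ℤ (b - c) +ℤ + 0 ≡ (a *ℤ b +ℤ + 0) - (a *ℤ c +ℤ + 0)
  ring = solve-∀
⊛-distribˡ-minus f g h (suc n) = begin
  (f ⊛ (λ i → g i - h i)) (suc n)
    ≡⟨ ⊛-suc f (λ i → g i - h i) n ⟩
  f 0 *ℤ (g (suc n) - h (suc n)) +ℤ ((f ∘ suc) ⊛ (λ i → g i - h i)) n
    ≡⟨ cong (_+ℤ_ (f 0 *ℤ (g (suc n) - h (suc n)))) (⊛-distribˡ-minus (f ∘ suc) g h n) ⟩
  f 0 *ℤ (g (suc n) - h (suc n)) +ℤ (((f ∘ suc) ⊛ g) n - ((f ∘ suc) ⊛ h) n)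
    ≡⟨ ring (f 0) (g (suc n)) (h (suc n)) (((f ∘ suc) ⊛ g) n) (((f ∘ suc) ⊛ h) n) ⟩
  (f 0 *ℤ g (suc n) +ℤ ((f ∘ suc) ⊛ g) n) - (f 0 *ℤ h (suc n) +ℤ ((f ∘ suc) ⊛ h) n)
    ≡⟨ cong₂ _-_ (⊛-suc f g n) (⊛-suc f h n) ⟨
  (f ⊛ g) (suc n) - (f ⊛ h) (suc n) ∎
  where
  ring : ∀ a b c x y → a *ℤ (b - c) +ℤ (x - y) ≡ (a *ℤ b +ℤ x) - (a *ℤ c +ℤ y)
  ring = solve-∀

-- The hypotheses say that h = (1 + x) g.
⊛-onePlusX : ∀ (f g h : Series) → h 0 ≡ g 0 → (∀ i → h (suc i) ≡ g i +ℤ g (suc i)) →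
  ∀ n → (f ⊛ h) (suc n) ≡ (f ⊛ g) n +ℤ (f ⊛ g) (suc n)
⊛-onePlusX f g h h₀ hₛ zero = begin
  (f ⊛ h) 1                                   ≡⟨ ⊛-suc f h 0 ⟩
  f 0 *ℤ h 1 +ℤ ((f ∘ suc) ⊛ h) 0             ≡⟨ cong₂ (λ x y → f 0 *ℤ x +ℤ y) (hₛ 0) (⊛-zero (f ∘ suc) h) ⟩
  f 0 *ℤ (g 0 +ℤ g 1) +ℤ f 1 *ℤ h 0           ≡⟨ cong (λ x → f 0 *ℤ (g 0 +ℤ g 1) +ℤ f 1 *ℤ x) h₀ ⟩
  f 0 *ℤ (g 0 +ℤ g 1) +ℤ f 1 *ℤ g 0           ≡⟨ ring (f 0) (f 1) (g 0) (g 1) ⟩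
  f 0 *ℤ g 0 +ℤ (f 0 *ℤ g 1 +ℤ f 1 *ℤ g 0)    ≡⟨ cong₂ _+ℤ_ (⊛-zero f g) (⊛-one f g) ⟨
  (f ⊛ g) 0 +ℤ (f ⊛ g) 1                      ∎
  where
  ⊛-one : ∀ (f g : Series) → (f ⊛ g) 1 ≡ f 0 *ℤ g 1 +ℤ f 1 *ℤ g 0
  ⊛-one f g = trans (⊛-suc f g 0) (cong (_+ℤ_ (f 0 *ℤ g 1)) (⊛-zero (f ∘ suc) g))
  ring : ∀ a b c d → a *ℤ (c +ℤ d) +ℤ b *ℤ c ≡ a *ℤ c +ℤ (a *ℤ d +ℤ b *ℤ c)
  ring = solve-∀
⊛-onePlusX f g h h₀ hₛ (suc n) = begin
  (f ⊛ h) (suc (suc n))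
    ≡⟨ ⊛-suc f h (suc n) ⟩
  f 0 *ℤ h (suc (suc n)) +ℤ ((f ∘ suc) ⊛ h) (suc n)
    ≡⟨ cong₂ (λ x y → f 0 *ℤ x +ℤ y) (hₛ (suc n)) (⊛-onePlusX (f ∘ suc) g h h₀ hₛ n) ⟩
  f 0 *ℤ (g (suc n) +ℤ g (suc (suc n))) +ℤ (((f ∘ suc) ⊛ g) n +ℤ ((f ∘ suc) ⊛ g) (suc n))
    ≡⟨ ring (f 0) (g (suc n)) (g (suc (suc n))) (((f ∘ suc) ⊛ g) n) (((f ∘ suc) ⊛ g) (suc n)) ⟩
  (f 0 *ℤ g (suc n) +ℤ ((f ∘ suc) ⊛ g) n) +ℤ (f 0 *ℤ g (suc (suc n)) +ℤ ((f ∘ suc) ⊛ g) (suc n))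
    ≡⟨ cong₂ _+ℤ_ (⊛-suc f g n) (⊛-suc f g (suc n)) ⟨
  (f ⊛ g) (suc n) +ℤ (f ⊛ g) (suc (suc n)) ∎
  where
  ring : ∀ a b c x y → a *ℤ (b +ℤ c) +ℤ (x +ℤ y) ≡ (a *ℤ b +ℤ x) +ℤ (a *ℤ c +ℤ y)
  ring = solve-∀

onePlusXPow-suc : ∀ m i → onePlusXPow (suc m) (suc i) ≡ onePlusXPow m i +ℤ onePlusXPow m (suc i)
onePlusXPow-suc m i = trans (cong +_ (sym (nCk+nC[k+1]≡[n+1]C[k+1] m i))) (ℤ.pos-+ (m C i) (m C suc i))

⊛-onePlusXPow-suc : ∀ f m n →
  (f ⊛ onePlusXPow (suc m)) (suc n) ≡ (f ⊛ onePlusXPow m) n +ℤ (f ⊛ onePlusXPow m) (suc n)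
⊛-onePlusXPow-suc f m = ⊛-onePlusX f (onePlusXPow m) (onePlusXPow (suc m)) refl (onePlusXPow-suc m)

module _ {A B : Set} {P : Pred B 0ℓ} (P? : Decidable P) where

  filter-map : ∀ (g : A → B) xs → filter P? (map g xs) ≡ map g (filter (P? ∘ g) xs)
  filter-map g [] = refl
  filter-map g (x ∷ xs) with P? (g x)
  ... | yes _ = cong (g x ∷_) (filter-map g xs)
  ... | no  _ = filter-map g xs

  length-filter-concatMap : ∀ (f : A → List B) xs →
    length (filter P? (concatMap f xs)) ≡ sum (map (length ∘ filter P? ∘ f) xs)
  length-filter-concatMap f [] = refl
  length-filter-concatMap f (x ∷ xs) = begin
    length (filter P? (f x ++ concatMap f xs))
      ≡⟨ cong length (filter-++ P? (f x) (concatMap f xs)) ⟩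
    length (filter P? (f x) ++ filter P? (concatMap f xs))
      ≡⟨ length-++ (filter P? (f x)) ⟩
    length (filter P? (f x)) + length (filter P? (concatMap f xs))
      ≡⟨ cong (_+_ (length (filter P? (f x)))) (length-filter-concatMap f xs) ⟩
    sum (map (length ∘ filter P? ∘ f) (x ∷ xs)) ∎

tabulate-toℕ : ∀ {A : Set} n (f : ℕ → A) → tabulate {n = n} (f ∘ toℕ) ≡ applyUpTo f n
tabulate-toℕ zero    f = refl
tabulate-toℕ (suc n) f = cong (f 0 ∷_) (tabulate-toℕ n (f ∘ suc))

applyUpTo-cong : ∀ {A : Set} {f g : ℕ → A} → f ≗ g → ∀ n → applyUpTo f n ≡ applyUpTo g n
applyUpTo-cong f≗g zero    = refl
applyUpTo-cong f≗g (suc n) = cong₂ _∷_ (f≗g 0) (applyUpTo-cong (f≗g ∘ suc) n)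

sum-applyUpTo-dropZeros : ∀ v d (f : ℕ → ℕ) → (∀ i → i < v → f i ≡ 0) →
  sum (applyUpTo f (v + d)) ≡ sum (applyUpTo (f ∘ (_+_ v)) d)
sum-applyUpTo-dropZeros zero    d f f≡0 = refl
sum-applyUpTo-dropZeros (suc v) d f f≡0 = begin
  f 0 + sum (applyUpTo (f ∘ suc) (v + d))
    ≡⟨ cong (_+ sum (applyUpTo (f ∘ suc) (v + d))) (f≡0 0 (s≤s z≤n)) ⟩
  sum (applyUpTo (f ∘ suc) (v + d))
    ≡⟨ sum-applyUpTo-dropZeros v d (f ∘ suc) (λ i → f≡0 (suc i) ∘ s≤s) ⟩
  sum (applyUpTo (f ∘ (_+_ (suc v))) d) ∎

Above : ∀ {k n} → ℕ → Vec (Fin k) n → Set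
Above v []      = ⊤
Above v (x ∷ _) = v < val x

above? : ∀ {k n} v (w : Vec (Fin k) n) → Dec (Above v w)
above? v []      = yes tt
above? v (x ∷ _) = v <? val x

above-0 : ∀ {k n} (w : Vec (Fin k) n) → Above 0 w
above-0 []      = tt
above-0 (_ ∷ _) = s≤s z≤n

EvenUpAbove : ∀ {k n} → ℕ → Vec (Fin k) n → Set
EvenUpAbove v w = EvenUp w × Above v w

evenUpAbove? : ∀ {k n} v (w : Vec (Fin k) n) → Dec (EvenUpAbove v w)
evenUpAbove? v w = evenUp? w ×-dec above? v w

threshold : ℕ → ℕ
threshold m with 2 ∣? m
... | yes _ = m
... | no  _ = 0

threshold-even : ∀ t → threshold (2 * t) ≡ 2 * t
threshold-even t with 2 ∣? 2 * t
... | yes _    = refl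
... | no  2∤2t = contradiction (m∣m*n t) 2∤2t

threshold-odd : ∀ t → threshold (suc (2 * t)) ≡ 0
threshold-odd t with 2 ∣? suc (2 * t)
... | yes (divides q eq) = contradiction (trans (*-comm 2 q) (sym eq)) (even≢odd q t)
... | no  _              = refl

module _ {k n : ℕ} where

  evenUp-∷ : ∀ (x : Fin k) (w : Vec (Fin k) n) →
    EvenUp (x ∷ w) ⇔ (EvenUp w × (Even (val x) → Above (val x) w))
  evenUp-∷ x w = mk⇔ (λ eu → tail eu , head w eu) (λ (eu , ab) → cons w eu ab)
    where
    tail : EvenUp (x ∷ w) → EvenUp w
    tail eu i j j≡1+i = eu (suc i) (suc j) (cong suc j≡1+i)
    head : ∀ w → EvenUp (x ∷ w) → Even (val x) → Above (val x) w
    head []      eu ev = tt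
    head (y ∷ w) eu ev = eu zero (suc zero) refl ev
    cons : ∀ w → EvenUp w → (Even (val x) → Above (val x) w) → EvenUp (x ∷ w)
    cons (y ∷ w) eu ab zero    (suc zero)    refl   = ab
    cons w       eu ab (suc i) (suc j)       j≡1+i  = eu i j (cong pred j≡1+i)
    cons []      eu ab zero    (suc ())      _
    cons (y ∷ w) eu ab zero    (suc (suc j)) ()
    cons w       eu ab zero    zero          ()
    cons w       eu ab (suc i) zero          ()

  evenUpAbove-∷ : ∀ v (x : Fin k) (w : Vec (Fin k) n) →
    EvenUpAbove v (x ∷ w) ⇔ (v < val x × EvenUpAbove (threshold (val x)) w)
  evenUpAbove-∷ v x w with 2 ∣? val x
  ... | yes ev = mk⇔ (λ (eu , v<x) → v<x , proj₁ (to eu) , proj₂ (to eu) ev)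
                     (λ (v<x , eu , ab) → from (eu , λ _ → ab) , v<x)
    where open Equivalence (evenUp-∷ x w)
  ... | no odd = mk⇔ (λ (eu , v<x) → v<x , proj₁ (to eu) , above-0 w)
                     (λ (v<x , eu , _) → from (eu , λ ev → contradiction ev odd) , v<x)
    where open Equivalence (evenUp-∷ x w)

module _ (k : ℕ) where

  aAbove : ℕ → ℕ → ℕ
  aAbove n v = length (filter (evenUpAbove? v) (words k n))

  aAbove-emptyWord : ∀ v → aAbove 0 v ≡ 1
  aAbove-emptyWord v = cong length (filter-accept (evenUpAbove? {k} v) {xs = []} ((λ ()) , tt))

  aAbove-0≡a : ∀ n → aAbove n 0 ≡ a k n
  aAbove-0≡a n = cong length
    (filter-≐ (evenUpAbove? 0) evenUp? (proj₁ , λ {w} eu → eu , above-0 w) (words k n))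

  aAbove-suc-≥ : ∀ n v → k ≤ v → aAbove (suc n) v ≡ 0
  aAbove-suc-≥ n v k≤v = cong length
    (filter-none (evenUpAbove? v) {words k (suc n)} (universal noneAbove (words k (suc n))))
    where
    noneAbove : (w : Vec (Fin k) (suc n)) → ¬ EvenUpAbove v w
    noneAbove (x ∷ _) (_ , v<x) = <-irrefl refl (<-≤-trans v<x (≤-trans (toℕ<n x) k≤v))

  length-filter-∷-above : ∀ n v (x : Fin k) → v < val x →
    length (filter (evenUpAbove? v ∘ (x ∷_)) (words k n)) ≡ aAbove n (threshold (val x))
  length-filter-∷-above n v x v<x = cong length
    (filter-≐ (evenUpAbove? v ∘ (x ∷_)) (evenUpAbove? (threshold (val x)))
      ((λ {w} → proj₂ ∘ Equivalence.to (evenUpAbove-∷ v x w))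
      , (λ {w} → Equivalence.from (evenUpAbove-∷ v x w) ∘ (v<x ,_)))
      (words k n))

  length-filter-∷-notAbove : ∀ n v (x : Fin k) → ¬ v < val x →
    length (filter (evenUpAbove? v ∘ (x ∷_)) (words k n)) ≡ 0
  length-filter-∷-notAbove n v x v≮x = cong length
    (filter-none (evenUpAbove? v ∘ (x ∷_)) {words k n} (universal (λ w → v≮x ∘ proj₂) (words k n)))

  aAbove-suc-byFirstLetter : ∀ n v →
    aAbove (suc n) v ≡ sum (map (λ x → length (filter (evenUpAbove? v ∘ (x ∷_)) (words k n))) (allFin k))
  aAbove-suc-byFirstLetter n v = begin
    aAbove (suc n) v
      ≡⟨ length-filter-concatMap (evenUpAbove? v) (λ x → map (x ∷_) (words k n)) (allFin k) ⟩
    sum (map (λ x → length (filter (evenUpAbove? v) (map (x ∷_) (words k n)))) (allFin k))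
      ≡⟨ cong sum (map-cong withFirst (allFin k)) ⟩
    sum (map (λ x → length (filter (evenUpAbove? v ∘ (x ∷_)) (words k n))) (allFin k)) ∎
    where
    withFirst : ∀ x → length (filter (evenUpAbove? v) (map (x ∷_) (words k n)))
                    ≡ length (filter (evenUpAbove? v ∘ (x ∷_)) (words k n))
    withFirst x = trans (cong length (filter-map (evenUpAbove? v) (x ∷_) (words k n)))
                        (length-map (x ∷_) (filter (evenUpAbove? v ∘ (x ∷_)) (words k n)))

  aAbove-suc : ∀ n v d → v + d ≡ k →
    aAbove (suc n) v ≡ sum (applyUpTo (λ i → aAbove n (threshold (suc (v + i)))) d)
  aAbove-suc n v d v+d≡k = begin
    aAbove (suc n) v
      ≡⟨ aAbove-suc-byFirstLetter n v ⟩
    sum (map (λ x → length (filter (evenUpAbove? v ∘ (x ∷_)) (words k n))) (allFin k))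
      ≡⟨ cong sum (map-cong (λ x → countStartingWith x (v <? val x)) (allFin k)) ⟩
    sum (map (startingWith ∘ toℕ) (allFin k))
      ≡⟨ cong sum (trans (map-tabulate id (startingWith ∘ toℕ)) (tabulate-toℕ k startingWith)) ⟩
    sum (applyUpTo startingWith k)
      ≡⟨ cong (sum ∘ applyUpTo startingWith) v+d≡k ⟨
    sum (applyUpTo startingWith (v + d))
      ≡⟨ sum-applyUpTo-dropZeros v d startingWith (λ i i<v → startingWith-notAbove i (<⇒≱ i<v ∘ s≤s⁻¹)) ⟩
    sum (applyUpTo (startingWith ∘ (_+_ v)) d)
      ≡⟨ cong sum (applyUpTo-cong (λ i → startingWith-above (v + i) (s≤s (m≤m+n v i))) d) ⟩
    sum (applyUpTo (λ i → aAbove n (threshold (suc (v + i)))) d) ∎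
    where
    startingWith : ℕ → ℕ
    startingWith i = if does (v <? suc i) then aAbove n (threshold (suc i)) else 0
    startingWith-above : ∀ i → v < suc i → startingWith i ≡ aAbove n (threshold (suc i))
    startingWith-above i v<1+i = cong (if_then aAbove n (threshold (suc i)) else 0) (dec-true (v <? suc i) v<1+i)
    startingWith-notAbove : ∀ i → ¬ v < suc i → startingWith i ≡ 0
    startingWith-notAbove i v≮1+i = cong (if_then aAbove n (threshold (suc i)) else 0) (dec-false (v <? suc i) v≮1+i)
    countStartingWith : ∀ x → Dec (v < val x) → length (filter (evenUpAbove? v ∘ (x ∷_)) (words k n)) ≡ startingWith (toℕ x)
    countStartingWith x (yes v<x) = trans (length-filter-∷-above n v x v<x) (sym (startingWith-above (toℕ x) v<x))
    countStartingWith x (no  v≮x) = trans (length-filter-∷-notAbove n v x v≮x) (sym (startingWith-notAbove (toℕ x) v≮x))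

  aAbove-suc-peel : ∀ n v d → v + suc d ≡ k →
    aAbove (suc n) v ≡ aAbove n (threshold (suc v)) + aAbove (suc n) (suc v)
  aAbove-suc-peel n v d v+1+d≡k = begin
    aAbove (suc n) v
      ≡⟨ aAbove-suc n v (suc d) v+1+d≡k ⟩
    h (v + 0) + sum (applyUpTo (h ∘ (_+_ v) ∘ suc) d)
      ≡⟨ cong₂ _+_ (cong h (+-identityʳ v)) (cong sum (applyUpTo-cong (cong h ∘ +-suc v) d)) ⟩
    h v + sum (applyUpTo (h ∘ (_+_ (suc v))) d)
      ≡⟨ cong (_+_ (h v)) (aAbove-suc n (suc v) d (trans (sym (+-suc v d)) v+1+d≡k)) ⟨
    h v + aAbove (suc n) (suc v) ∎
    where
    h : ℕ → ℕ
    h m = aAbove n (threshold (suc m))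

  aAbove-suc-peelEven : ∀ n t d → 2 * t + suc d ≡ k →
    aAbove (suc n) (2 * t) ≡ a k n + aAbove (suc n) (suc (2 * t))
  aAbove-suc-peelEven n t d 2t+1+d≡k = begin
    aAbove (suc n) (2 * t)
      ≡⟨ aAbove-suc-peel n (2 * t) d 2t+1+d≡k ⟩
    aAbove n (threshold (suc (2 * t))) + aAbove (suc n) (suc (2 * t))
      ≡⟨ cong (λ m → aAbove n m + aAbove (suc n) (suc (2 * t))) (threshold-odd t) ⟩
    aAbove n 0 + aAbove (suc n) (suc (2 * t))
      ≡⟨ cong (_+ aAbove (suc n) (suc (2 * t))) (aAbove-0≡a n) ⟩
    a k n + aAbove (suc n) (suc (2 * t)) ∎

  aAbove-suc-peelOdd : ∀ n t d → suc (2 * t) + suc d ≡ k →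
    aAbove (suc n) (suc (2 * t)) ≡ aAbove n (2 * suc t) + aAbove (suc n) (2 * suc t)
  aAbove-suc-peelOdd n t d 2t+2+d≡k = begin
    aAbove (suc n) (suc (2 * t))
      ≡⟨ aAbove-suc-peel n (suc (2 * t)) d 2t+2+d≡k ⟩
    aAbove n (threshold (suc (suc (2 * t)))) + aAbove (suc n) (suc (suc (2 * t)))
      ≡⟨ cong (λ m → aAbove n (threshold m) + aAbove (suc n) m) (*-suc 2 t) ⟨
    aAbove n (threshold (2 * suc t)) + aAbove (suc n) (2 * suc t)
      ≡⟨ cong (λ m → aAbove n m + aAbove (suc n) (2 * suc t)) (threshold-even (suc t)) ⟩
    aAbove n (2 * suc t) + aAbove (suc n) (2 * suc t) ∎

  aAbove-suc-even : ∀ n t r → 2 * t + suc (suc r) ≡ k →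
    aAbove (suc n) (2 * t) ≡ a k n + (aAbove n (2 * suc t) + aAbove (suc n) (2 * suc t))
  aAbove-suc-even n t r 2t+2+r≡k =
    trans (aAbove-suc-peelEven n t (suc r) 2t+2+r≡k)
          (cong (_+_ (a k n)) (aAbove-suc-peelOdd n t r (trans (sym (+-suc (2 * t) (suc r))) 2t+2+r≡k)))

[2+r]/2≡1+r/2 : ∀ r → suc (suc r) / 2 ≡ suc (r / 2)
[2+r]/2≡1+r/2 r = m/n≡1+[m∸n]/n {suc (suc r)} {2} (s≤s (s≤s z≤n))

EvenThresholdIdentity : ℕ → ℕ → Set
EvenThresholdIdentity k n = ∀ t r → 2 * t + r ≡ k →
  + aAbove k n (2 * t) +ℤ A k n ≡ onePlusXPow (r / 2) n +ℤ (A k ⊛ onePlusXPow ((r + 1) / 2)) n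

evenThresholdIdentity-zero : ∀ k → EvenThresholdIdentity k 0
evenThresholdIdentity-zero k t r _ = begin
  + aAbove k 0 (2 * t) +ℤ A k 0              ≡⟨ cong (λ m → + m +ℤ A k 0) (aAbove-emptyWord k (2 * t)) ⟩
  + 1 +ℤ A k 0                               ≡⟨ cong (+ 1 +ℤ_) (ℤ.*-identityʳ (A k 0)) ⟨
  + 1 +ℤ A k 0 *ℤ + 1                        ≡⟨ cong (+ 1 +ℤ_) (⊛-zero (A k) (onePlusXPow ((r + 1) / 2))) ⟨
  + 1 +ℤ (A k ⊛ onePlusXPow ((r + 1) / 2)) 0 ∎

evenThresholdIdentity-suc : ∀ k n → EvenThresholdIdentity k n → EvenThresholdIdentity k (suc n)
evenThresholdIdentity-suc k n IHₙ t zero 2t+0≡k = begin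
  + aAbove k (suc n) (2 * t) +ℤ A k (suc n) ≡⟨ cong (λ m → + m +ℤ A k (suc n)) (aAbove-suc-≥ k n (2 * t) k≤2t) ⟩
  + 0 +ℤ A k (suc n)                        ≡⟨ cong (+ 0 +ℤ_) (ℤ.*-identityʳ (A k (suc n))) ⟨
  + 0 +ℤ A k (suc n) *ℤ + 1                 ≡⟨ cong (+ 0 +ℤ_) (⊛-impulse (A k) (onePlusXPow 0) (λ _ → refl) (suc n)) ⟨
  + 0 +ℤ (A k ⊛ onePlusXPow 0) (suc n)      ∎
  where
  k≤2t : k ≤ 2 * t
  k≤2t = ≤-reflexive (trans (sym 2t+0≡k) (+-identityʳ (2 * t)))
evenThresholdIdentity-suc k n IHₙ t (suc zero) 2t+1≡k = begin
  + aAbove k (suc n) (2 * t) +ℤ A k (suc n)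
    ≡⟨ cong (λ m → + m +ℤ A k (suc n)) (aAbove-suc-peelEven k n t 0 2t+1≡k) ⟩
  + (a k n + aAbove k (suc n) (suc (2 * t))) +ℤ A k (suc n)
    ≡⟨ cong (λ m → + (a k n + m) +ℤ A k (suc n)) (aAbove-suc-≥ k n (suc (2 * t)) k≤2t+1) ⟩
  + (a k n + 0) +ℤ A k (suc n)
    ≡⟨ ring (A k n) (A k (suc n)) ⟩
  + 0 +ℤ (A k n *ℤ + 1 +ℤ A k (suc n) *ℤ + 1)
    ≡⟨ cong (+ 0 +ℤ_) (cong₂ _+ℤ_ (impulse n) (impulse (suc n))) ⟨
  + 0 +ℤ ((A k ⊛ onePlusXPow 0) n +ℤ (A k ⊛ onePlusXPow 0) (suc n))
    ≡⟨ cong (+ 0 +ℤ_) (⊛-onePlusXPow-suc (A k) 0 n) ⟨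
  + 0 +ℤ (A k ⊛ onePlusXPow 1) (suc n) ∎
  where
  k≤2t+1 : k ≤ suc (2 * t)
  k≤2t+1 = ≤-reflexive (trans (sym 2t+1≡k) (+-comm (2 * t) 1))
  impulse : ∀ m → (A k ⊛ onePlusXPow 0) m ≡ A k m *ℤ + 1
  impulse = ⊛-impulse (A k) (onePlusXPow 0) (λ _ → refl)
  ring : ∀ a b → a +ℤ + 0 +ℤ b ≡ + 0 +ℤ (a *ℤ + 1 +ℤ b *ℤ + 1)
  ring = solve-∀
evenThresholdIdentity-suc k n IHₙ t (suc (suc r)) 2t+2+r≡k = begin
  + aAbove k (suc n) (2 * t) +ℤ A k (suc n)
    ≡⟨ cong (λ m → + m +ℤ A k (suc n)) (aAbove-suc-even k n t r 2t+2+r≡k) ⟩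
  + (a k n + (aAbove k n (2 * suc t) + aAbove k (suc n) (2 * suc t))) +ℤ A k (suc n)
    ≡⟨ ring (A k n) (+ aAbove k n (2 * suc t)) (+ aAbove k (suc n) (2 * suc t)) (A k (suc n)) ⟩
  (+ aAbove k n (2 * suc t) +ℤ A k n) +ℤ (+ aAbove k (suc n) (2 * suc t) +ℤ A k (suc n))
    ≡⟨ cong₂ _+ℤ_ (IHₙ (suc t) r 2[1+t]+r≡k) (evenThresholdIdentity-suc k n IHₙ (suc t) r 2[1+t]+r≡k) ⟩
  (B e n +ℤ (A k ⊛ B o) n) +ℤ (B e (suc n) +ℤ (A k ⊛ B o) (suc n))
    ≡⟨ ring′ (B e n) ((A k ⊛ B o) n) (B e (suc n)) ((A k ⊛ B o) (suc n)) ⟩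
  (B e n +ℤ B e (suc n)) +ℤ ((A k ⊛ B o) n +ℤ (A k ⊛ B o) (suc n))
    ≡⟨ cong₂ _+ℤ_ (onePlusXPow-suc e n) (⊛-onePlusXPow-suc (A k) o n) ⟨
  B (suc e) (suc n) +ℤ (A k ⊛ B (suc o)) (suc n)
    ≡⟨ cong₂ (λ e′ o′ → B e′ (suc n) +ℤ (A k ⊛ B o′) (suc n)) ([2+r]/2≡1+r/2 r) ([2+r]/2≡1+r/2 (r + 1)) ⟨
  B (suc (suc r) / 2) (suc n) +ℤ (A k ⊛ B ((suc (suc r) + 1) / 2)) (suc n) ∎
  where
  B = onePlusXPow
  e = r / 2
  o = (r + 1) / 2
  2[1+t]+r≡k : 2 * suc t + r ≡ k
  2[1+t]+r≡k = trans (shift t r) 2t+2+r≡k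
    where
    shift : ∀ t r → 2 * suc t + r ≡ 2 * t + suc (suc r)
    shift = ℕ-Solver.solve-∀
  ring : ∀ a x y b → a +ℤ (x +ℤ y) +ℤ b ≡ (x +ℤ a) +ℤ (y +ℤ b)
  ring = solve-∀
  ring′ : ∀ a b c d → (a +ℤ b) +ℤ (c +ℤ d) ≡ (a +ℤ c) +ℤ (b +ℤ d)
  ring′ = solve-∀

evenThresholdIdentity : ∀ k n → EvenThresholdIdentity k n
evenThresholdIdentity k zero    = evenThresholdIdentity-zero k
evenThresholdIdentity k (suc n) = evenThresholdIdentity-suc k n (evenThresholdIdentity k n)

-- The identity holds for every k.
theorem1 : (k : ℕ) → 2 ≤ k → (n : ℕ) →
    (A k ⊛ denom ((k + 1) / 2)) n ≡ onePlusXPow (k / 2) n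
theorem1 k _ n = begin
  (A k ⊛ denom o) n                          ≡⟨ ⊛-distribˡ-minus (A k) two (onePlusXPow o) n ⟩
  (A k ⊛ two) n - X                          ≡⟨ cong (_- X) (⊛-impulse (A k) two (λ _ → refl) n) ⟩
  A k n *ℤ + 2 - X                           ≡⟨ ring (A k n) X ⟩
  (A k n +ℤ A k n) - X                       ≡⟨ cong (_- X) twiceA ⟩
  (onePlusXPow (k / 2) n +ℤ X) - X           ≡⟨ ring′ (onePlusXPow (k / 2) n) X ⟩
  onePlusXPow (k / 2) n                      ∎
  where
  o = (k + 1) / 2
  X = (A k ⊛ onePlusXPow o) n
  twiceA : A k n +ℤ A k n ≡ onePlusXPow (k / 2) n +ℤ X
  twiceA = trans (cong (λ m → + m +ℤ A k n) (sym (aAbove-0≡a k n))) (evenThresholdIdentity k n 0 k refl)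
  ring : ∀ a c → a *ℤ + 2 - c ≡ (a +ℤ a) - c
  ring = solve-∀
  ring′ : ∀ b c → (b +ℤ c) - c ≡ b
  ring′ = solve-∀
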